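{- For $n\geqslant 2$, the map $\phi:V(\text{CQ}_n)\to V(\text{CQ}_n)$, $\phi(u)=f_{n-2}(u)$, is an automorphism of $\text{CQ}_n$.
   Context: Two 2-bit strings $x_2x_1$ and $y_2y_1$ are pair related, written $x_2x_1\sim y_2y_1$, iff $(x_2x_1,y_2y_1)\in\{(00,00),(10,10),(01,11),(11,01)\}$. The $n$-dimensional crossed cube $\text{CQ}_n$ has as vertices all binary strings $u=u_{n-1}\ldots u_0$ of length $n$. Two vertices $u,v$ are adjacent iff there is an index $x$ with $0\leqslant x\leqslant n-1$ such that: (1) $v_x\neq u_x$; (2) if $x$ is odd, $v_{x-1}=u_{x-1}$; (3) $v_i=u_i$ for all $i>x$; (4) $u_{2i+1}u_{2i}\sim v_{2i+1}v_{2i}$ for all $0\leqslant i\leqslant\lfloor x/2\rfloor-1$. For $0\leqslant i\leqslant n-1$, $f_i(u)$ denotes the string obtained from $u$ by negating the bit $u_i$. -}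

module Defs where

open import Data.Nat using (ℕ; zero; suc; _+_; _*_; _<_; _≤_; _/_)
open import Data.Bool using (Bool; true; false; not)
open import Data.Fin using (Fin; toℕ)
open import Data.Vec using (Vec; lookup; updateAt)
open import Data.Product using (Σ; _×_; ∃-syntax)
open import Relation.Binary.PropositionalEquality using (_≡_)
open import Relation.Nullary using (¬_)

open import Function using (_⇔_)

-- A vertex of CQ_n: binary string u = u_{n-1} ... u_0, stored as a vector
-- with  lookup u i = u_i  (index i is the bit position, 0 = least significant).
Vertex : ℕ → Set
Vertex n = Vec Bool n

data PairRel : Bool → Bool → Bool → Bool → Set where
  p00 : PairRel false false false false
  p10 : PairRel true  false true  false
  p01 : PairRel false true  true  true
  p11 : PairRel true  true  false true

_at_ : ∀ {n} → Vertex n → Fin n → Bool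
u at i = lookup u i

Adj : (n : ℕ) → Vertex n → Vertex n → Set
Adj n u v = ∃[ x ]
  ( ¬ (v at x ≡ u at x)
  × ((y : Fin n) → suc (toℕ y) ≡ toℕ x → (∃[ k ] toℕ x ≡ suc (2 * k)) → v at y ≡ u at y)
  × ((i : Fin n) → toℕ x < toℕ i → v at i ≡ u at i)
  × ((i : ℕ) → suc i ≤ toℕ x / 2 →
       (a b : Fin n) → toℕ a ≡ suc (2 * i) → toℕ b ≡ 2 * i →
       PairRel (u at a) (u at b) (v at a) (v at b)) )

flipAt : ∀ {n} → Fin n → Vertex n → Vertex n
flipAt i u = updateAt u i not

IsAutomorphism : (n : ℕ) → (Vertex n → Vertex n) → Set
IsAutomorphism n φ =
  (∀ u v → φ u ≡ φ v → u ≡ v) × (∀ w → ∃[ u ] φ u ≡ w) ×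
  (∀ u v → Adj n u v ⇔ Adj n (φ u) (φ v))

-- Flipping a bit preserves, position by position, whether two vertices agree,
-- so conditions (1)-(3) of adjacency are untouched.  Condition (4) only
-- constrains pairs lying strictly below the dimension x, whose low bit 2i
-- satisfies 2i + 2 ≤ x ≤ n - 1; so bit n-2 (or n-1) is never such a low bit,
-- and flipping the high bit of a pair preserves the pair relation.  Since
-- f_{n-2} is an involution, it is an automorphism.
module Submission where

open import Defs
open import Data.Nat using (ℕ; suc; _+_; _*_; _/_; _∸_; _≤_; _<_)
open import Data.Nat.Properties
  using (*-suc; *-comm; *-monoˡ-≤; ≤-trans; <-irrefl; ≤-<-trans; m≤n+m∸n; module ≤-Reasoning)
open import Data.Nat.DivMod using (m/n*n≤m)
open import Data.Bool using (not)
open import Data.Bool.Properties using (not-involutive; not-injective)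
open import Data.Fin using (Fin; toℕ; fromℕ<; _≟_)
open import Data.Fin.Properties using (toℕ-fromℕ<; toℕ<n)
open import Data.Vec.Properties
  using (lookup∘updateAt; lookup∘updateAt′; updateAt-updateAt; updateAt-id-local)
open import Data.Product using (_,_)
open import Relation.Binary.PropositionalEquality
open import Relation.Nullary using (yes; no)
open import Function using (_⇔_; mk⇔; Equivalence)
open import Function.Construct.Identity using (⇔-id)

not-PairRel-high : ∀ {a b c d} → PairRel a b c d → PairRel (not a) b (not c) d
not-PairRel-high p00 = p10
not-PairRel-high p10 = p00
not-PairRel-high p01 = p11
not-PairRel-high p11 = p01

module _ {n : ℕ} (p : Fin n) where

  flipAt-involutive : ∀ u → flipAt p (flipAt p u) ≡ u
  flipAt-involutive u =
    trans (updateAt-updateAt p u) (updateAt-id-local p u (not-involutive (u at p)))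

  flipAt-at-≢ : ∀ {j} → j ≢ p → ∀ u → flipAt p u at j ≡ u at j
  flipAt-at-≢ j≢p u = lookup∘updateAt′ _ p j≢p u

  flipAt-at-≡⇔ : ∀ j u v → (flipAt p v at j ≡ flipAt p u at j) ⇔ (v at j ≡ u at j)
  flipAt-at-≡⇔ j u v with j ≟ p
  ... | yes refl rewrite lookup∘updateAt p {not} u | lookup∘updateAt p {not} v =
    mk⇔ not-injective (cong not)
  ... | no j≢p rewrite flipAt-at-≢ j≢p u | flipAt-at-≢ j≢p v = ⇔-id _

  flipAt-PairRel : ∀ (a b : Fin n) → b ≢ p → ∀ u v →
    PairRel (u at a) (u at b) (v at a) (v at b) →
    PairRel (flipAt p u at a) (flipAt p u at b) (flipAt p v at a) (flipAt p v at b)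
  flipAt-PairRel a b b≢p u v pr
    rewrite flipAt-at-≢ b≢p u | flipAt-at-≢ b≢p v with a ≟ p
  ... | yes refl rewrite lookup∘updateAt p {not} u | lookup∘updateAt p {not} v =
    not-PairRel-high pr
  ... | no a≢p rewrite flipAt-at-≢ a≢p u | flipAt-at-≢ a≢p v = pr

pair-below-dimension : ∀ x i → suc i ≤ x / 2 → 2 + 2 * i ≤ x
pair-below-dimension x i i<x/2 = begin
  2 + 2 * i  ≡⟨ *-suc 2 i ⟨
  2 * suc i  ≡⟨ *-comm 2 (suc i) ⟩
  suc i * 2  ≤⟨ *-monoˡ-≤ 2 i<x/2 ⟩
  x / 2 * 2  ≤⟨ m/n*n≤m x 2 ⟩
  x          ∎
  where open ≤-Reasoning

top-bit-not-pair-low : ∀ {n} {p : Fin n} → n ≤ 2 + toℕ p →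
  ∀ (x b : Fin n) i → suc i ≤ toℕ x / 2 → toℕ b ≡ 2 * i → b ≢ p
top-bit-not-pair-low {n} n≤2+p x b i i<x/2 b≡2i refl = <-irrefl refl n<n
  where
  n≤x : n ≤ toℕ x
  n≤x = ≤-trans n≤2+p
    (subst (λ k → 2 + k ≤ toℕ x) (sym b≡2i) (pair-below-dimension (toℕ x) i i<x/2))

  n<n : n < n
  n<n = ≤-<-trans n≤x (toℕ<n x)

flipAt-preserves-Adj : ∀ {n} (p : Fin n) → n ≤ 2 + toℕ p →
  ∀ u v → Adj n u v → Adj n (flipAt p u) (flipAt p v)
flipAt-preserves-Adj p n≤2+p u v (x , differ , odd-agree , above-agree , pairs) =
    x
  , (λ same → differ (reflects-agreement x same))
  , (λ y y+1≡x odd → keeps-agreement y (odd-agree y y+1≡x odd))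
  , (λ i x<i → keeps-agreement i (above-agree i x<i))
  , λ i i<x/2 a b a≡2i+1 b≡2i →
      flipAt-PairRel p a b (top-bit-not-pair-low n≤2+p x b i i<x/2 b≡2i) u v
        (pairs i i<x/2 a b a≡2i+1 b≡2i)
  where
  keeps-agreement : ∀ j → v at j ≡ u at j → flipAt p v at j ≡ flipAt p u at j
  keeps-agreement j = Equivalence.from (flipAt-at-≡⇔ p j u v)

  reflects-agreement : ∀ j → flipAt p v at j ≡ flipAt p u at j → v at j ≡ u at j
  reflects-agreement j = Equivalence.to (flipAt-at-≡⇔ p j u v)

involution-automorphism : ∀ {n} (φ : Vertex n → Vertex n) → (∀ u → φ (φ u) ≡ u) →
  (∀ u v → Adj n u v → Adj n (φ u) (φ v)) → IsAutomorphism n φ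
involution-automorphism {n} φ φφ≡id preserves =
    (λ u v φu≡φv → trans (sym (φφ≡id u)) (trans (cong φ φu≡φv) (φφ≡id v)))
  , (λ w → φ w , φφ≡id w)
  , λ u v → mk⇔ (preserves u v)
      (λ adj → subst₂ (Adj n) (φφ≡id u) (φφ≡id v) (preserves (φ u) (φ v) adj))

flipAt-isAutomorphism : ∀ n (p : Fin n) → n ≤ 2 + toℕ p → IsAutomorphism n (flipAt p)
flipAt-isAutomorphism n p n≤2+p =
  involution-automorphism (flipAt p) (flipAt-involutive p) (flipAt-preserves-Adj p n≤2+p)

lemma3 : (n : ℕ) → 2 ≤ n → (lt : n ∸ 2 < n) →
    IsAutomorphism n (flipAt (fromℕ< lt))
lemma3 n _ lt = flipAt-isAutomorphism n (fromℕ< lt)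
  (subst (λ k → n ≤ 2 + k) (sym (toℕ-fromℕ< lt)) (m≤n+m∸n n 2))
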